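{- Let $P\subset\mathbb{R}^d$ be a lattice-face $d$-simplex with vertices $v_1,\dots,v_{d+1}$. Then for every $\sigma\in\mathfrak{S}_d$ and every $1\le k\le d$, $z(\sigma,k)/z(\sigma,k-1)\in\mathbb{Z}$, where $z(\sigma,0)=1$.
   Context: Write $v_i=(x_{i,1},\dots,x_{i,d})$. For $1\le k\le d$: $X(\sigma,k)$ is the $(k+1)\times(k+1)$ matrix with rows $(1,x_{\sigma(r),1},\dots,x_{\sigma(r),k})$, $r=1,\dots,k$, then $(1,x_{d+1,1},\dots,x_{d+1,k})$; $Y(\sigma,k)$ the $k\times k$ matrix with rows $(1,x_{\sigma(r),1},\dots,x_{\sigma(r),k-1})$, $r=1,\dots,k$; $z(\sigma,k)=\det X(\sigma,k)/\det Y(\sigma,k)$. Lattice-face polytopes are defined recursively with $\pi:\mathbb{R}^n\to\mathbb{R}^{n-1}$ forgetting the last coordinate: a $1$-dimensional polytope is lattice-face if it is integral; for $n\ge2$, an $n$-polytope with vertex set $V$ is lattice-face if for every $n$-subset $U\subset V$, $\pi(\mathrm{conv}(U))$ is a lattice-face $(n-1)$-polytope and $\pi(H_U\cap\mathbb{Z}^n)=\mathbb{Z}^{n-1}$, where $H_U$ is the affine span of $U$.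
   Formalization: The simplex P has its vertices in ℚ^d rather than ℝ^d. -}

module Defs where

open import Data.Nat as ℕ using (ℕ; zero; suc; _≤_; s≤s)
open import Data.Nat.Properties using (≤-trans; n≤1+n)
open import Data.Integer as ℤ using (ℤ)
open import Data.Fin using (Fin; zero; suc; inject₁; inject≤; punchIn; fromℕ)
open import Data.Fin.Permutation using (Permutation′; _⟨$⟩ʳ_)
open import Data.Rational using (ℚ; 0ℚ; 1ℚ; _+_; _*_; -_; _÷_; ≢-nonZero; _/_)
open import Data.Rational.Properties using (_≟_)
open import Data.Product using (Σ; _×_; ∃)
open import Relation.Binary.PropositionalEquality using (_≡_; _≢_)
open import Relation.Nullary using (yes; no)
open import Function.Bundles using (_⇔_)

Point : ℕ → Set
Point n = Fin n → ℚ

Mat : ℕ → Set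
Mat n = Fin n → Fin n → ℚ

sumF : ∀ {n} → (Fin n → ℚ) → ℚ
sumF {zero}  f = 0ℚ
sumF {suc n} f = f zero + sumF (λ i → f (suc i))

sign : ∀ {n} → Fin n → ℚ
sign zero    = 1ℚ
sign (suc j) = - sign j

det : ∀ n → Mat n → ℚ
det zero    M = 1ℚ
det (suc n) M =
  sumF (λ j → sign j * (M zero j * det n (λ r c → M (suc r) (punchIn j c))))

-- Total division on ℚ (junk value 0 for division by 0).
_÷₀_ : ℚ → ℚ → ℚ
p ÷₀ q with q ≟ 0ℚ
... | yes _  = 0ℚ
... | no q≢0 = _÷_ p q {{≢-nonZero q≢0}}

IsInt : ℚ → Set
IsInt q = ∃ λ (m : ℤ) → q ≡ m / 1

π : ∀ {n} → Point (suc n) → Point n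
π x c = x (inject₁ c)

AffInd : ∀ {n} → (Fin (suc n) → Point n) → Set
AffInd {n} p = det (suc n) M ≢ 0ℚ
  where
  M : Mat (suc n)
  M r zero    = 1ℚ
  M r (suc c) = p r c

InAffSpan : ∀ {m n} → (Fin m → Point n) → Point n → Set
InAffSpan {m} {n} U x =
  Σ (Fin m → ℚ) λ λs → (sumF λs ≡ 1ℚ) × (∀ c → x c ≡ sumF (λ i → λs i * U i c))

IntPoint : ∀ {n} → Point n → Set
IntPoint y = ∀ c → IsInt (y c)

LatticeCond : ∀ {m n} → (Fin m → Point (suc n)) → Set
LatticeCond {m} {n} U =
  (y : Point n) →
    IntPoint y ⇔ (Σ (Point (suc n)) λ x → InAffSpan U x × IntPoint x × (∀ c → π x c ≡ y c))

-- Lattice-face (n+1)-simplex with vertices p_0,…,p_{n+1} in ℚ^(n+1),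
-- the recursive definition specialised to simplices: the n+1-subsets of
-- the vertex set are obtained by omitting one vertex i.
LatticeFaceSimplex : ∀ n → (Fin (suc (suc n)) → Point (suc n)) → Set
LatticeFaceSimplex zero    p = AffInd p × (∀ i → IsInt (p i zero))
LatticeFaceSimplex (suc n) p =
  AffInd p ×
  (∀ (i : Fin (suc (suc (suc n)))) →
     LatticeFaceSimplex n (λ r → π (p (punchIn i r))) × LatticeCond (λ r → p (punchIn i r)))

rowEntries : ∀ {d k} → k ≤ d → Point d → Fin (suc k) → ℚ
rowEntries k≤d x zero    = 1ℚ
rowEntries k≤d x (suc c) = x (inject≤ c k≤d)

appendRow : ∀ {d k} → (Fin k → Point d) → Point d → Fin (suc k) → Point d
appendRow {k = zero}  f w zero    = w
appendRow {k = suc k} f w zero    = f zero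
appendRow {k = suc k} f w (suc r) = appendRow (λ i → f (suc i)) w r

module _ {d : ℕ} (v : Fin (suc d) → Point d) (σ : Permutation′ d) where

  -- v_{σ(r)} for r : Fin k (r = 1..k in the paper)
  vσ : ∀ {k} → k ≤ d → Fin k → Point d
  vσ k≤d r = v (inject₁ (σ ⟨$⟩ʳ inject≤ r k≤d))

  Xmat : ∀ k → k ≤ d → Mat (suc k)
  Xmat k k≤d r c = rowEntries k≤d (appendRow (vσ k≤d) (v (fromℕ d)) r) c

  -- Y(σ,k) for k = k'+1: k×k, rows (1, x_{σ(r),1..k-1}) for r = 1..k
  Ymat : ∀ k' → suc k' ≤ d → Mat (suc k')
  Ymat k' sk'≤d r c = rowEntries (≤-trans (n≤1+n k') sk'≤d) (vσ sk'≤d r) c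

  z : ∀ k → k ≤ d → ℚ
  z zero    _    = 1ℚ
  z (suc k) k≤d  = det (suc (suc k)) (Xmat (suc k) k≤d) ÷₀ det (suc k) (Ymat k k≤d)

-- For k ≥ 2 let F(ρ) be the determinant of the matrix with rows (1, x_{σ(r),1}, …, x_{σ(r),k}),
-- r = 1, …, k, followed by ρ, and G(ρ) the analogous determinant one size smaller.  Both are linear in ρ,
-- and z(σ,k) = F(X) / F(e), z(σ,k-1) = G(X′) / G(e), where X, X′ are the rows of v_{d+1} and e is the
-- last unit vector (expanding along the row e leaves Y(σ,k), resp. Y(σ,k-1)).
-- Projected to its first k coordinates, the face spanned by v_{σ(1)}, …, v_{σ(k)}, v_{d+1} is again a
-- lattice-face simplex.  Its lattice condition yields integral points a₀, a₁ in the affine span of the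
-- facet opposite v_{d+1} and b₀, b₁ in that of the facet opposite v_{σ(k)}, lying over 0 and over the
-- last unit vector of ℤ^{k-1}.  F vanishes on the first span and equals μ·F(X) on the second, μ being
-- the barycentric weight of v_{d+1}; after projection G behaves in the same way, with the same μ.
-- Since (b₁ - b₀) - (a₁ - a₀) = N·e with N ∈ ℤ while π(b₁ - b₀) = e, the weights μ₀, μ₁ of b₀, b₁
-- satisfy (μ₁ - μ₀)·F(X) = N·F(e) and (μ₁ - μ₀)·G(X′) = G(e), so the ratio is N.  For k = 1 the ratio
-- is x_{d+1,1} - x_{σ(1),1}, and the vertices of a lattice-face simplex have integral first coordinates.

module Submission where

open import Defs
open import Data.Nat using (ℕ; zero; suc; _≤_; _<_; _≤′_; ≤′-refl; ≤′-step; s≤s)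
import Data.Nat.Properties as ℕ
open import Data.Nat.Properties using (≤-trans; n≤1+n)
open import Data.Integer as ℤ using (ℤ; -[1+_])
import Data.Integer.Properties as ℤ
open import Data.Nat.Coprimality using (1-coprimeTo) renaming (sym to coprime-sym)
open import Data.Fin using (Fin; zero; suc; inject₁; inject≤; punchIn; punchOut; fromℕ)
open import Data.Fin.Properties
  using (suc-injective; toℕ-injective; toℕ-inject₁; toℕ-inject≤; inject≤-refl; inject₁-injective; inject≤-injective;
         fromℕ≢inject₁; punchIn-injective; punchInᵢ≢i; punchOut-injective; punchIn-punchOut;
         any?; ¬∀⟶∃¬; <⇒notInjective)
  renaming (_≟_ to _≟ᶠ_)
open import Data.Fin.Permutation using (Permutation′; _⟨$⟩ʳ_; _⟨$⟩ˡ_; inverseˡ)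
open import Data.Rational
  using (ℚ; mkℚ; 0ℚ; 1ℚ; ½; _+_; _*_; -_; _-_; 1/_; _/_; ≢-nonZero)
open import Data.Rational.Properties
  using (_≟_; ↥p/↧p≡p; *-inverseʳ; *-zeroˡ; *-identityˡ; *-identityʳ;
         *-assoc; *-zeroʳ; *-inverseˡ; +-identityʳ; +-*-commutativeRing)
open import Data.Vec.Functional using (_∷_)
open import Data.Product using (Σ; ∃; ∃₂; _×_; _,_; proj₁; proj₂)
open import Data.Sum using (_⊎_; inj₁; inj₂)
open import Data.Maybe using (map)
open import Level using (0ℓ)
open import Function using (_∘_)
open import Function.Bundles using (Equivalence)
open import Function.Definitions using (Injective)
open import Relation.Binary.PropositionalEquality
open import Relation.Nullary using (¬_; Dec; yes; no)
open import Relation.Nullary.Decidable.Core using (dec⇒maybe)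
open import Relation.Nullary.Negation using (contradiction)
open import Algebra.Bundles using (CommutativeRing)
open import Algebra.Properties.Semiring.Sum (CommutativeRing.semiring +-*-commutativeRing)
  using (sum; sum-cong-≗; ∑-distrib-+; ∑-comm; *-distribˡ-sum; *-distribʳ-sum; sum-init-last; sum-replicate-zero)
import Tactic.RingSolver.Core.AlmostCommutativeRing as ACR
open import Tactic.RingSolver using (solve-∀)

ℚ-ring : ACR.AlmostCommutativeRing 0ℓ 0ℓ
ℚ-ring = ACR.fromCommutativeRing +-*-commutativeRing (λ x → map sym (dec⇒maybe (x ≟ 0ℚ)))

neg-involutive : ∀ x → - - x ≡ x
neg-involutive = solve-∀ ℚ-ring

x-x≡0 : ∀ x → x - x ≡ 0ℚ
x-x≡0 = solve-∀ ℚ-ring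

x-0≡x : ∀ x → x - 0ℚ ≡ x
x-0≡x = solve-∀ ℚ-ring

-- Finite sums

sumF≡sum : ∀ {n} (f : Fin n → ℚ) → sumF f ≡ sum f
sumF≡sum {zero}  f = refl
sumF≡sum {suc n} f = cong (f zero +_) (sumF≡sum (f ∘ suc))

sumF-cong : ∀ {n} {f g : Fin n → ℚ} → (∀ i → f i ≡ g i) → sumF f ≡ sumF g
sumF-cong {f = f} {g} f≗g = trans (sumF≡sum f) (trans (sum-cong-≗ f≗g) (sym (sumF≡sum g)))

sumF-distrib-+ : ∀ {n} (f g : Fin n → ℚ) → sumF (λ i → f i + g i) ≡ sumF f + sumF g
sumF-distrib-+ f g = begin
  sumF (λ i → f i + g i)  ≡⟨ sumF≡sum (λ i → f i + g i) ⟩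
  sum (λ i → f i + g i)   ≡⟨ ∑-distrib-+ f g ⟩
  sum f + sum g           ≡⟨ sym (cong₂ _+_ (sumF≡sum f) (sumF≡sum g)) ⟩
  sumF f + sumF g         ∎
  where open ≡-Reasoning

*-distribˡ-sumF : ∀ {n} a (f : Fin n → ℚ) → a * sumF f ≡ sumF (λ i → a * f i)
*-distribˡ-sumF a f = begin
  a * sumF f              ≡⟨ cong (a *_) (sumF≡sum f) ⟩
  a * sum f               ≡⟨ *-distribˡ-sum a f ⟩
  sum (λ i → a * f i)     ≡⟨ sym (sumF≡sum (λ i → a * f i)) ⟩
  sumF (λ i → a * f i)    ∎
  where open ≡-Reasoning

*-distribʳ-sumF : ∀ {n} a (f : Fin n → ℚ) → sumF f * a ≡ sumF (λ i → f i * a)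
*-distribʳ-sumF a f = begin
  sumF f * a              ≡⟨ cong (_* a) (sumF≡sum f) ⟩
  sum f * a               ≡⟨ *-distribʳ-sum a f ⟩
  sum (λ i → f i * a)     ≡⟨ sym (sumF≡sum (λ i → f i * a)) ⟩
  sumF (λ i → f i * a)    ∎
  where open ≡-Reasoning

-‿distrib-sumF : ∀ {n} (f : Fin n → ℚ) → - sumF f ≡ sumF (λ i → - f i)
-‿distrib-sumF f = begin
  - sumF f                      ≡⟨ -x≡-1*x (sumF f) ⟩
  - 1ℚ * sumF f                 ≡⟨ *-distribˡ-sumF (- 1ℚ) f ⟩
  sumF (λ i → - 1ℚ * f i)       ≡⟨ sumF-cong (λ i → sym (-x≡-1*x (f i))) ⟩
  sumF (λ i → - f i)            ∎
  where
  open ≡-Reasoning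
  -x≡-1*x : ∀ x → - x ≡ - 1ℚ * x
  -x≡-1*x = solve-∀ ℚ-ring

sumF-zero : ∀ {n} {f : Fin n → ℚ} → (∀ i → f i ≡ 0ℚ) → sumF f ≡ 0ℚ
sumF-zero {n} {f} f≗0 = trans (sumF≡sum f) (trans (sum-cong-≗ f≗0) (sum-replicate-zero n))

sumF-comm : ∀ {m n} (f : Fin m → Fin n → ℚ) →
            sumF (λ i → sumF (λ j → f i j)) ≡ sumF (λ j → sumF (λ i → f i j))
sumF-comm f = begin
  sumF (λ i → sumF (λ j → f i j))  ≡⟨ sumF-cong (λ i → sumF≡sum (f i)) ⟩
  sumF (λ i → sum (λ j → f i j))   ≡⟨ sumF≡sum (λ i → sum (λ j → f i j)) ⟩
  sum (λ i → sum (λ j → f i j))    ≡⟨ ∑-comm f ⟩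
  sum (λ j → sum (λ i → f i j))    ≡⟨ sym (sumF≡sum (λ j → sum (λ i → f i j))) ⟩
  sumF (λ j → sum (λ i → f i j))   ≡⟨ sumF-cong (λ j → sym (sumF≡sum (λ i → f i j))) ⟩
  sumF (λ j → sumF (λ i → f i j))  ∎
  where open ≡-Reasoning

sumF-init-last : ∀ {n} (f : Fin (suc n) → ℚ) → sumF f ≡ sumF (f ∘ inject₁) + f (fromℕ n)
sumF-init-last {n} f = begin
  sumF f                            ≡⟨ sumF≡sum f ⟩
  sum f                             ≡⟨ sum-init-last f ⟩
  sum (f ∘ inject₁) + f (fromℕ n)   ≡⟨ cong (_+ f (fromℕ n)) (sym (sumF≡sum (f ∘ inject₁))) ⟩
  sumF (f ∘ inject₁) + f (fromℕ n)  ∎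
  where open ≡-Reasoning

sumF-scaled : ∀ {m} (λs χ f : Fin m → ℚ) {c} → (∀ i → f i ≡ χ i * c) →
              sumF (λ i → λs i * f i) ≡ sumF (λ i → λs i * χ i) * c
sumF-scaled λs χ f {c} f≈ = trans
  (sumF-cong λ i → trans (cong (λs i *_) (f≈ i)) (sym (*-assoc (λs i) (χ i) c)))
  (sym (*-distribʳ-sumF c (λ i → λs i * χ i)))

-- Integers and total division in ℚ

fromℤ : ℤ → ℚ
fromℤ a = mkℚ a 0 (coprime-sym (1-coprimeTo ℤ.∣ a ∣))

/1≡fromℤ : ∀ a → a / 1 ≡ fromℤ a
/1≡fromℤ a = ↥p/↧p≡p (fromℤ a)

IsInt-+ : ∀ {p q} → IsInt p → IsInt q → IsInt (p + q)
IsInt-+ (a , refl) (b , refl) = a ℤ.+ b , (begin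
  a / 1 + b / 1                        ≡⟨ cong₂ _+_ (/1≡fromℤ a) (/1≡fromℤ b) ⟩
  fromℤ a + fromℤ b                    ≡⟨⟩
  (a ℤ.* ℤ.+ 1 ℤ.+ b ℤ.* ℤ.+ 1) / 1    ≡⟨ cong₂ (λ x y → (x ℤ.+ y) / 1) (ℤ.*-identityʳ a) (ℤ.*-identityʳ b) ⟩
  (a ℤ.+ b) / 1                        ∎)
  where open ≡-Reasoning

IsInt-neg : ∀ {p} → IsInt p → IsInt (- p)
IsInt-neg (ℤ.+ zero    , refl) = ℤ.+ 0 , refl
IsInt-neg (ℤ.+[1+ n ]  , refl) = -[1+ n ] , refl
IsInt-neg (-[1+ n ]    , refl) = ℤ.+[1+ n ] , neg-involutive (ℤ.+[1+ n ] / 1)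

IsInt-- : ∀ {p q} → IsInt p → IsInt q → IsInt (p - q)
IsInt-- p∈ℤ q∈ℤ = IsInt-+ p∈ℤ (IsInt-neg q∈ℤ)

p÷₀0≡0 : ∀ p → p ÷₀ 0ℚ ≡ 0ℚ
p÷₀0≡0 p with 0ℚ ≟ 0ℚ
... | yes _   = refl
... | no 0≢0  = contradiction refl 0≢0

0÷₀q≡0 : ∀ q → 0ℚ ÷₀ q ≡ 0ℚ
0÷₀q≡0 q with q ≟ 0ℚ
... | yes _   = refl
... | no q≢0  = *-zeroˡ ((1/ q) {{≢-nonZero q≢0}})

[p÷₀q]*q≡p : ∀ p {q} → q ≢ 0ℚ → (p ÷₀ q) * q ≡ p
[p÷₀q]*q≡p p {q} q≢0 with q ≟ 0ℚ
... | yes q≡0 = contradiction q≡0 q≢0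
... | no q≢0′ = begin
  p * 1/ q * q      ≡⟨ *-assoc p (1/ q) q ⟩
  p * (1/ q * q)    ≡⟨ cong (p *_) (*-inverseˡ q) ⟩
  p * 1ℚ            ≡⟨ *-identityʳ p ⟩
  p                 ∎
  where
  open ≡-Reasoning
  instance _ = ≢-nonZero q≢0′

[p*q]÷₀q≡p : ∀ p {q} → q ≢ 0ℚ → (p * q) ÷₀ q ≡ p
[p*q]÷₀q≡p p {q} q≢0 with q ≟ 0ℚ
... | yes q≡0 = contradiction q≡0 q≢0
... | no q≢0′ = begin
  p * q * 1/ q      ≡⟨ *-assoc p q (1/ q) ⟩
  p * (q * 1/ q)    ≡⟨ cong (p *_) (*-inverseʳ q) ⟩
  p * 1ℚ            ≡⟨ *-identityʳ p ⟩
  p                 ∎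
  where
  open ≡-Reasoning
  instance _ = ≢-nonZero q≢0′

*-cancelʳ-≡ : ∀ {p q r} → r ≢ 0ℚ → p * r ≡ q * r → p ≡ q
*-cancelʳ-≡ {p} {q} {r} r≢0 pr≡qr = begin
  p              ≡⟨ sym ([p*q]÷₀q≡p p r≢0) ⟩
  (p * r) ÷₀ r   ≡⟨ cong (_÷₀ r) pr≡qr ⟩
  (q * r) ÷₀ r   ≡⟨ [p*q]÷₀q≡p q r≢0 ⟩
  q              ∎
  where open ≡-Reasoning

p÷₀1≡p : ∀ p → p ÷₀ 1ℚ ≡ p
p÷₀1≡p p = trans (cong (_÷₀ 1ℚ) (sym (*-identityʳ p))) ([p*q]÷₀q≡p p {1ℚ} λ ())

-- The second alternative is the junk value of ÷₀ when b or d is 0.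
ratio-of-ratios : ∀ {a b c d μ N} → μ * a ≡ N * b → μ * c ≡ d →
                  (a ÷₀ b) ÷₀ (c ÷₀ d) ≡ N ⊎ (a ÷₀ b) ÷₀ (c ÷₀ d) ≡ 0ℚ
ratio-of-ratios {a} {b} {c} {d} {μ} {N} μa≡Nb μc≡d = cases (b ≟ 0ℚ) (d ≟ 0ℚ)
  where
  open ≡-Reasoning
  x = a ÷₀ b
  y = c ÷₀ d
  cases : Dec (b ≡ 0ℚ) → Dec (d ≡ 0ℚ) → x ÷₀ y ≡ N ⊎ x ÷₀ y ≡ 0ℚ
  cases (yes refl) _        = inj₂ (trans (cong (_÷₀ y) (p÷₀0≡0 a)) (0÷₀q≡0 y))
  cases (no _)     (yes refl) = inj₂ (trans (cong (x ÷₀_) (p÷₀0≡0 c)) (p÷₀0≡0 x))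
  cases (no b≢0)   (no d≢0)   = inj₁ (begin
    x ÷₀ y        ≡⟨ cong (_÷₀ y) x≡N*y ⟩
    (N * y) ÷₀ y  ≡⟨ [p*q]÷₀q≡p N y≢0 ⟩
    N             ∎)
    where
    μx≡N : μ * x ≡ N
    μx≡N = *-cancelʳ-≡ b≢0 (begin
      μ * x * b     ≡⟨ *-assoc μ x b ⟩
      μ * (x * b)   ≡⟨ cong (μ *_) ([p÷₀q]*q≡p a b≢0) ⟩
      μ * a         ≡⟨ μa≡Nb ⟩
      N * b         ∎)
    μy≡1 : μ * y ≡ 1ℚ
    μy≡1 = *-cancelʳ-≡ d≢0 (begin
      μ * y * d     ≡⟨ *-assoc μ y d ⟩
      μ * (y * d)   ≡⟨ cong (μ *_) ([p÷₀q]*q≡p c d≢0) ⟩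
      μ * c         ≡⟨ μc≡d ⟩
      d             ≡⟨ sym (*-identityˡ d) ⟩
      1ℚ * d        ∎)
    y≢0 : y ≢ 0ℚ
    y≢0 y≡0 = contradiction (trans (sym μy≡1) (trans (cong (μ *_) y≡0) (*-zeroʳ μ))) λ ()
    x≡N*y : x ≡ N * y
    x≡N*y = begin
      x             ≡⟨ sym (*-identityʳ x) ⟩
      x * 1ℚ        ≡⟨ cong (x *_) (sym μy≡1) ⟩
      x * (μ * y)   ≡⟨ regroup x μ y ⟩
      μ * x * y     ≡⟨ cong (_* y) μx≡N ⟩
      N * y         ∎
      where
      regroup : ∀ x μ y → x * (μ * y) ≡ μ * x * y
      regroup = solve-∀ ℚ-ring

ratio-of-ratios-integral : ∀ {a b c d μ N} → IsInt N → μ * a ≡ N * b → μ * c ≡ d →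
                           IsInt ((a ÷₀ b) ÷₀ (c ÷₀ d))
ratio-of-ratios-integral {a} {b} {c} {d} {μ} {N} N∈ℤ μa≡Nb μc≡d
  with ratio-of-ratios {a} {b} {c} {d} {μ} {N} μa≡Nb μc≡d
... | inj₁ ratio≡N = subst IsInt (sym ratio≡N) N∈ℤ
... | inj₂ ratio≡0 = subst IsInt (sym ratio≡0) (ℤ.+ 0 , refl)

-- Determinants

punchIn-fromℕ : ∀ {n} (c : Fin n) → punchIn (fromℕ n) c ≡ inject₁ c
punchIn-fromℕ zero    = refl
punchIn-fromℕ (suc c) = cong suc (punchIn-fromℕ c)

punchIn-inject₁ : ∀ {n} (j : Fin (suc n)) (c : Fin n) → punchIn (inject₁ j) (inject₁ c) ≡ inject₁ (punchIn j c)
punchIn-inject₁ zero    c       = refl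
punchIn-inject₁ (suc j) zero    = refl
punchIn-inject₁ (suc j) (suc c) = cong suc (punchIn-inject₁ j c)

sign-inject₁ : ∀ {n} (j : Fin n) → sign (inject₁ j) ≡ sign j
sign-inject₁ zero    = refl
sign-inject₁ (suc j) = cong -_ (sign-inject₁ j)

data InjectOrLast {n} : Fin (suc n) → Set where
  inner : (j : Fin n) → InjectOrLast (inject₁ j)
  last  : InjectOrLast (fromℕ n)

injectOrLast : ∀ {n} (i : Fin (suc n)) → InjectOrLast i
injectOrLast {zero}  zero    = last
injectOrLast {suc n} zero    = inner zero
injectOrLast {suc n} (suc i) with injectOrLast i
... | inner j = inner (suc j)
... | last    = last

inject≤-inject₁ : ∀ {m n} (c : Fin m) .(p : suc m ≤ n) .(p′ : m ≤ n) → inject≤ (inject₁ c) p ≡ inject≤ c p′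
inject≤-inject₁ c p p′ =
  toℕ-injective (trans (toℕ-inject≤ (inject₁ c) p) (trans (toℕ-inject₁ c) (sym (toℕ-inject≤ c p′))))

minor : ∀ {n} → Mat (suc n) → Fin (suc n) → Mat n
minor M j r c = M (suc r) (punchIn j c)

laplaceTerm : ∀ {n} → Mat (suc n) → Fin (suc n) → ℚ
laplaceTerm {n} M j = sign j * (M zero j * det n (minor M j))

det-cong : ∀ n {M N : Mat n} → (∀ r c → M r c ≡ N r c) → det n M ≡ det n N
det-cong zero    M≈N = refl
det-cong (suc n) M≈N = sumF-cong λ j →
  cong₂ (λ x D → sign j * (x * D)) (M≈N zero j) (det-cong n (λ r c → M≈N (suc r) (punchIn j c)))

mutual
  det-linear : ∀ n (r : Fin n) a b {M M₁ M₂ : Mat n} →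
               (∀ i → i ≢ r → ∀ c → M₁ i c ≡ M i c) →
               (∀ i → i ≢ r → ∀ c → M₂ i c ≡ M i c) →
               (∀ c → M r c ≡ a * M₁ r c + b * M₂ r c) →
               det n M ≡ a * det n M₁ + b * det n M₂
  det-linear (suc n) r a b {M} {M₁} {M₂} M₁≈M M₂≈M Mr = begin
    sumF (laplaceTerm M)
      ≡⟨ sumF-cong (laplaceTerm-linear r a b M₁≈M M₂≈M Mr) ⟩
    sumF (λ j → a * laplaceTerm M₁ j + b * laplaceTerm M₂ j)
      ≡⟨ sumF-distrib-+ (λ j → a * laplaceTerm M₁ j) (λ j → b * laplaceTerm M₂ j) ⟩
    sumF (λ j → a * laplaceTerm M₁ j) + sumF (λ j → b * laplaceTerm M₂ j)
      ≡⟨ sym (cong₂ _+_ (*-distribˡ-sumF a (laplaceTerm M₁)) (*-distribˡ-sumF b (laplaceTerm M₂))) ⟩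
    a * det (suc n) M₁ + b * det (suc n) M₂
      ∎
    where open ≡-Reasoning

  laplaceTerm-linear : ∀ {n} (r : Fin (suc n)) a b {M M₁ M₂ : Mat (suc n)} →
                       (∀ i → i ≢ r → ∀ c → M₁ i c ≡ M i c) →
                       (∀ i → i ≢ r → ∀ c → M₂ i c ≡ M i c) →
                       (∀ c → M r c ≡ a * M₁ r c + b * M₂ r c) →
                       ∀ j → laplaceTerm M j ≡ a * laplaceTerm M₁ j + b * laplaceTerm M₂ j
  laplaceTerm-linear {n} zero a b {M} {M₁} {M₂} M₁≈M M₂≈M M₀ j = begin
    sign j * (M zero j * D)
      ≡⟨ cong (λ x → sign j * (x * D)) (M₀ j) ⟩
    sign j * ((a * M₁ zero j + b * M₂ zero j) * D)
      ≡⟨ distrib a b (sign j) (M₁ zero j) (M₂ zero j) D ⟩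
    a * (sign j * (M₁ zero j * D)) + b * (sign j * (M₂ zero j * D))
      ≡⟨ cong₂ (λ D₁ D₂ → a * (sign j * (M₁ zero j * D₁)) + b * (sign j * (M₂ zero j * D₂)))
               (sameMinor M₁≈M) (sameMinor M₂≈M) ⟩
    a * laplaceTerm M₁ j + b * laplaceTerm M₂ j
      ∎
    where
    open ≡-Reasoning
    D = det n (minor M j)
    sameMinor : ∀ {N} → (∀ i → i ≢ zero → ∀ c → N i c ≡ M i c) → D ≡ det n (minor N j)
    sameMinor N≈M = det-cong n (λ r c → sym (N≈M (suc r) (λ ()) (punchIn j c)))
    distrib : ∀ a b s x y D → s * ((a * x + b * y) * D) ≡ a * (s * (x * D)) + b * (s * (y * D))
    distrib = solve-∀ ℚ-ring
  laplaceTerm-linear {n} (suc r) a b {M} {M₁} {M₂} M₁≈M M₂≈M Mr j = begin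
    sign j * (M zero j * det n (minor M j))
      ≡⟨ cong (λ D → sign j * (M zero j * D)) minorLinear ⟩
    sign j * (M zero j * (a * det n (minor M₁ j) + b * det n (minor M₂ j)))
      ≡⟨ distrib a b (sign j) (M zero j) (det n (minor M₁ j)) (det n (minor M₂ j)) ⟩
    a * (sign j * (M zero j * det n (minor M₁ j))) + b * (sign j * (M zero j * det n (minor M₂ j)))
      ≡⟨ cong₂ (λ x y → a * (sign j * (x * det n (minor M₁ j))) + b * (sign j * (y * det n (minor M₂ j))))
               (sym (M₁≈M zero (λ ()) j)) (sym (M₂≈M zero (λ ()) j)) ⟩
    a * laplaceTerm M₁ j + b * laplaceTerm M₂ j
      ∎
    where
    open ≡-Reasoning
    minorLinear : det n (minor M j) ≡ a * det n (minor M₁ j) + b * det n (minor M₂ j)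
    minorLinear = det-linear n r a b
      (λ i i≢r c → M₁≈M (suc i) (i≢r ∘ suc-injective) (punchIn j c))
      (λ i i≢r c → M₂≈M (suc i) (i≢r ∘ suc-injective) (punchIn j c))
      (λ c → Mr (punchIn j c))
    distrib : ∀ a b s x D₁ D₂ → s * (x * (a * D₁ + b * D₂)) ≡ a * (s * (x * D₁)) + b * (s * (x * D₂))
    distrib = solve-∀ ℚ-ring

det-zeroRow : ∀ n (r : Fin n) (M : Mat n) → (∀ c → M r c ≡ 0ℚ) → det n M ≡ 0ℚ
det-zeroRow n r M Mr≡0 =
  trans (det-linear n r 0ℚ 0ℚ (λ _ _ _ → refl) (λ _ _ _ → refl) (λ c → trans (Mr≡0 c) (sym (zeros (M r c)))))
        (zeros (det n M))
  where
  zeros : ∀ x → 0ℚ * x + 0ℚ * x ≡ 0ℚ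
  zeros = solve-∀ ℚ-ring

swap₀₁ : ∀ {n} → Fin (suc (suc n)) → Fin (suc (suc n))
swap₀₁ zero          = suc zero
swap₀₁ (suc zero)    = zero
swap₀₁ (suc (suc i)) = suc (suc i)

swapColumns₀₁ : ∀ {n} → Mat (suc (suc n)) → Mat (suc (suc n))
swapColumns₀₁ M r c = M r (swap₀₁ c)

mutual
  det-swapColumns₀₁ : ∀ n (M : Mat (suc (suc n))) → det (suc (suc n)) (swapColumns₀₁ M) ≡ - det (suc (suc n)) M
  det-swapColumns₀₁ n M = begin
    laplaceTerm M′ zero + (laplaceTerm M′ (suc zero) + sumF (λ j → laplaceTerm M′ (suc (suc j))))
      ≡⟨ cong₂ _+_ (cong (λ D → 1ℚ * (M zero (suc zero) * D)) minor₀)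
           (cong₂ _+_ (cong (λ D → - 1ℚ * (M zero zero * D)) minor₁)
                      (sumF-cong (laplaceTerm-swapColumns₀₁ M))) ⟩
    1ℚ * (M zero (suc zero) * D₁) + (- 1ℚ * (M zero zero * D₀) + sumF (λ j → - laplaceTerm M (suc (suc j))))
      ≡⟨ cong (λ S → 1ℚ * (M zero (suc zero) * D₁) + (- 1ℚ * (M zero zero * D₀) + S))
              (sym (-‿distrib-sumF (λ j → laplaceTerm M (suc (suc j))))) ⟩
    1ℚ * (M zero (suc zero) * D₁) + (- 1ℚ * (M zero zero * D₀) + - sumF (λ j → laplaceTerm M (suc (suc j))))
      ≡⟨ antisymmetry (M zero zero) (M zero (suc zero)) D₀ D₁ _ ⟩
    - det (suc (suc n)) M
      ∎
    where
    open ≡-Reasoning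
    M′ = swapColumns₀₁ M
    D₀ = det (suc n) (minor M zero)
    D₁ = det (suc n) (minor M (suc zero))
    minor₀ : det (suc n) (minor M′ zero) ≡ D₁
    minor₀ = det-cong (suc n) {minor M′ zero} {minor M (suc zero)} λ { r zero → refl ; r (suc c) → refl }
    minor₁ : det (suc n) (minor M′ (suc zero)) ≡ D₀
    minor₁ = det-cong (suc n) {minor M′ (suc zero)} {minor M zero} λ { r zero → refl ; r (suc c) → refl }
    antisymmetry : ∀ x y D₀ D₁ S → 1ℚ * (y * D₁) + (- 1ℚ * (x * D₀) + - S) ≡ - (1ℚ * (x * D₀) + (- 1ℚ * (y * D₁) + S))
    antisymmetry = solve-∀ ℚ-ring

  laplaceTerm-swapColumns₀₁ : ∀ {n} (M : Mat (suc (suc n))) (j : Fin n) →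
                              laplaceTerm (swapColumns₀₁ M) (suc (suc j)) ≡ - laplaceTerm M (suc (suc j))
  laplaceTerm-swapColumns₀₁ {suc n} M j = begin
    s * (x * det (suc (suc n)) (minor (swapColumns₀₁ M) (suc (suc j))))
      ≡⟨ cong (λ D → s * (x * D)) (trans swappedMinor (det-swapColumns₀₁ n (minor M (suc (suc j))))) ⟩
    s * (x * - det (suc (suc n)) (minor M (suc (suc j))))
      ≡⟨ pull-neg s x _ ⟩
    - laplaceTerm M (suc (suc j))
      ∎
    where
    open ≡-Reasoning
    s = sign (suc (suc j))
    x = M zero (suc (suc j))
    swappedMinor : det (suc (suc n)) (minor (swapColumns₀₁ M) (suc (suc j)))
                 ≡ det (suc (suc n)) (swapColumns₀₁ (minor M (suc (suc j))))
    swappedMinor = det-cong (suc (suc n)) {minor (swapColumns₀₁ M) (suc (suc j))} {swapColumns₀₁ (minor M (suc (suc j)))}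
      λ { r zero → refl ; r (suc zero) → refl ; r (suc (suc c)) → refl }
    pull-neg : ∀ s x D → s * (x * - D) ≡ - (s * (x * D))
    pull-neg = solve-∀ ℚ-ring

det-columnExpansion : ∀ n (M : Mat (suc n)) →
                      det (suc n) M ≡ sumF (λ i → sign i * (M i zero * det n (λ r c → M (punchIn i r) (suc c))))
det-columnExpansion zero    M = refl
det-columnExpansion (suc n) M = cong (laplaceTerm M zero +_) (begin
  sumF (λ j → sign (suc j) * (M zero (suc j) * det (suc n) (minor M (suc j))))
    ≡⟨ sumF-cong (λ j → cong (λ D → sign (suc j) * (M zero (suc j) * D)) (det-columnExpansion n (minor M (suc j)))) ⟩
  sumF (λ j → sign (suc j) * (M zero (suc j) * sumF (λ i → sign i * (M (suc i) zero * A i j))))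
    ≡⟨ sumF-cong (λ j → scale-sumF (sign (suc j)) (M zero (suc j)) (λ i → sign i * (M (suc i) zero * A i j))) ⟩
  sumF (λ j → sumF (λ i → sign (suc j) * (M zero (suc j) * (sign i * (M (suc i) zero * A i j)))))
    ≡⟨ sumF-comm (λ j i → sign (suc j) * (M zero (suc j) * (sign i * (M (suc i) zero * A i j)))) ⟩
  sumF (λ i → sumF (λ j → sign (suc j) * (M zero (suc j) * (sign i * (M (suc i) zero * A i j)))))
    ≡⟨ sumF-cong (λ i → sumF-cong (λ j → exchange (sign j) (M zero (suc j)) (sign i) (M (suc i) zero) (A i j))) ⟩
  sumF (λ i → sumF (λ j → sign (suc i) * (M (suc i) zero * (sign j * (M zero (suc j) * A i j)))))
    ≡⟨ sumF-cong (λ i → sym (scale-sumF (sign (suc i)) (M (suc i) zero) (λ j → sign j * (M zero (suc j) * A i j)))) ⟩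
  sumF (λ i → sign (suc i) * (M (suc i) zero * sumF (λ j → sign j * (M zero (suc j) * A i j))))
    ∎)
  where
  open ≡-Reasoning
  A : Fin (suc n) → Fin (suc n) → ℚ
  A i j = det n (λ r c → M (suc (punchIn i r)) (suc (punchIn j c)))
  scale-sumF : ∀ {m} s x (f : Fin m → ℚ) → s * (x * sumF f) ≡ sumF (λ i → s * (x * f i))
  scale-sumF s x f = trans (cong (s *_) (*-distribˡ-sumF x f)) (*-distribˡ-sumF s (λ i → x * f i))
  exchange : ∀ sj x si y a → - sj * (x * (si * (y * a))) ≡ - si * (y * (sj * (x * a)))
  exchange = solve-∀ ℚ-ring

transpose : ∀ {n} → Mat n → Mat n
transpose M r c = M c r

det-transpose : ∀ n (M : Mat n) → det n (transpose M) ≡ det n M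
det-transpose zero    M = refl
det-transpose (suc n) M = trans
  (sumF-cong λ j → cong (λ D → sign j * (M j zero * D)) (det-transpose n (λ r c → M (punchIn j r) (suc c))))
  (sym (det-columnExpansion n M))

swapRows₀₁ : ∀ {n} → Mat (suc (suc n)) → Mat (suc (suc n))
swapRows₀₁ M r c = M (swap₀₁ r) c

det-swapRows₀₁ : ∀ n (M : Mat (suc (suc n))) → det (suc (suc n)) (swapRows₀₁ M) ≡ - det (suc (suc n)) M
det-swapRows₀₁ n M = begin
  det (suc (suc n)) (swapRows₀₁ M)                 ≡⟨ sym (det-transpose (suc (suc n)) (swapRows₀₁ M)) ⟩
  det (suc (suc n)) (swapColumns₀₁ (transpose M))  ≡⟨ det-swapColumns₀₁ n (transpose M) ⟩
  - det (suc (suc n)) (transpose M)                ≡⟨ cong -_ (det-transpose (suc (suc n)) M) ⟩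
  - det (suc (suc n)) M                            ∎
  where open ≡-Reasoning

x≡-x⇒x≡0 : ∀ {x} → x ≡ - x → x ≡ 0ℚ
x≡-x⇒x≡0 {x} x≡-x = begin
  x              ≡⟨ halve x ⟩
  ½ * (x + x)    ≡⟨ cong (λ y → ½ * (x + y)) x≡-x ⟩
  ½ * (x + - x)  ≡⟨ cancel x ⟩
  0ℚ             ∎
  where
  open ≡-Reasoning
  halve : ∀ x → x ≡ ½ * (x + x)
  halve = solve-∀ ℚ-ring
  cancel : ∀ x → ½ * (x + - x) ≡ 0ℚ
  cancel = solve-∀ ℚ-ring

mutual
  det-equalRows : ∀ n (M : Mat n) {i j} → i ≢ j → (∀ c → M i c ≡ M j c) → det n M ≡ 0ℚ
  det-equalRows (suc n) M {zero}  {zero}  i≢j _     = contradiction refl i≢j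
  det-equalRows (suc n) M {zero}  {suc j} _   Mi≈Mj = det-equalRows₀ n M j Mi≈Mj
  det-equalRows (suc n) M {suc i} {zero}  _   Mi≈Mj = det-equalRows₀ n M i (sym ∘ Mi≈Mj)
  det-equalRows (suc n) M {suc i} {suc j} i≢j Mi≈Mj = det-equalRows-suc n M (i≢j ∘ cong suc) Mi≈Mj

  det-equalRows-suc : ∀ n (M : Mat (suc n)) {i j} → i ≢ j → (∀ c → M (suc i) c ≡ M (suc j) c) →
                      det (suc n) M ≡ 0ℚ
  det-equalRows-suc n M i≢j Mi≈Mj = sumF-zero λ k →
    trans (cong (λ D → sign k * (M zero k * D)) (det-equalRows n (minor M k) i≢j (λ c → Mi≈Mj (punchIn k c))))
          (trans (cong (sign k *_) (*-zeroʳ (M zero k))) (*-zeroʳ (sign k)))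

  det-equalRows₀ : ∀ n (M : Mat (suc n)) j → (∀ c → M zero c ≡ M (suc j) c) → det (suc n) M ≡ 0ℚ
  det-equalRows₀ (suc n) M zero M₀≈M₁ = x≡-x⇒x≡0 (trans
    (det-cong (suc (suc n)) {M} {swapRows₀₁ M}
       λ { zero c → M₀≈M₁ c ; (suc zero) c → sym (M₀≈M₁ c) ; (suc (suc r)) c → refl })
    (det-swapRows₀₁ n M))
  -- Swapping rows 0 and 1 moves the repeated pair of rows into every minor.
  det-equalRows₀ (suc n) M (suc j) M₀≈M = begin
    det (suc (suc n)) M                  ≡⟨ sym (neg-involutive _) ⟩
    - - det (suc (suc n)) M              ≡⟨ cong -_ (sym (det-swapRows₀₁ n M)) ⟩
    - det (suc (suc n)) (swapRows₀₁ M)   ≡⟨ cong -_ (det-equalRows-suc (suc n) (swapRows₀₁ M) {zero} {suc j} (λ ()) M₀≈M) ⟩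
    - 0ℚ                                 ≡⟨⟩
    0ℚ                                   ∎
    where open ≡-Reasoning

det₂ : ∀ (M : Mat 2) → det 2 M ≡ M zero zero * M (suc zero) (suc zero) - M zero (suc zero) * M (suc zero) zero
det₂ M = expand (M zero zero) (M zero (suc zero)) (M (suc zero) zero) (M (suc zero) (suc zero))
  where
  expand : ∀ a b c d → 1ℚ * (a * (1ℚ * (d * 1ℚ) + 0ℚ)) + (- 1ℚ * (b * (1ℚ * (c * 1ℚ) + 0ℚ)) + 0ℚ) ≡ a * d - b * c
  expand = solve-∀ ℚ-ring

lastUnit : ∀ {n} → Point (suc n)
lastUnit {zero}  zero    = 1ℚ
lastUnit {suc n} zero    = 0ℚ
lastUnit {suc n} (suc c) = lastUnit c

lastUnit-fromℕ : ∀ n → lastUnit (fromℕ n) ≡ 1ℚ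
lastUnit-fromℕ zero    = refl
lastUnit-fromℕ (suc n) = lastUnit-fromℕ n

lastUnit-inject₁ : ∀ {n} (c : Fin n) → lastUnit (inject₁ c) ≡ 0ℚ
lastUnit-inject₁ zero    = refl
lastUnit-inject₁ (suc c) = lastUnit-inject₁ c

lastUnit-punchIn : ∀ {n} (j c : Fin (suc n)) → lastUnit {suc n} (punchIn (inject₁ j) c) ≡ lastUnit c
lastUnit-punchIn         zero    c       = refl
lastUnit-punchIn {suc n} (suc j) zero    = refl
lastUnit-punchIn {suc n} (suc j) (suc c) = lastUnit-punchIn j c

lastUnit-integral : ∀ {n} → IntPoint (lastUnit {n})
lastUnit-integral {zero}  zero    = ℤ.+ 1 , refl
lastUnit-integral {suc n} zero    = ℤ.+ 0 , refl
lastUnit-integral {suc n} (suc c) = lastUnit-integral c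

det-lastRowUnit : ∀ n (M : Mat (suc n)) → (∀ c → M (fromℕ n) c ≡ lastUnit c) →
                  det (suc n) M ≡ det n (λ r c → M (inject₁ r) (inject₁ c))
det-lastRowUnit zero    M Mₗ = cong (λ x → 1ℚ * (x * 1ℚ) + 0ℚ) (Mₗ zero)
det-lastRowUnit (suc n) M Mₗ = begin
  sumF (laplaceTerm M)                                                 ≡⟨ sumF-init-last (laplaceTerm M) ⟩
  sumF (λ j → laplaceTerm M (inject₁ j)) + laplaceTerm M (fromℕ (suc n)) ≡⟨ cong₂ _+_ (sumF-cong innerTerm) lastTerm ⟩
  det (suc n) M′ + 0ℚ                                                  ≡⟨ +-identityʳ _ ⟩
  det (suc n) M′                                                       ∎
  where
  open ≡-Reasoning
  M′ : Mat (suc n)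
  M′ r c = M (inject₁ r) (inject₁ c)
  lastTerm : laplaceTerm M (fromℕ (suc n)) ≡ 0ℚ
  lastTerm = trans
    (cong (λ D → sign (fromℕ (suc n)) * (M zero (fromℕ (suc n)) * D))
          (det-zeroRow (suc n) (fromℕ n) (minor M (fromℕ (suc n))) λ c →
            trans (Mₗ (punchIn (fromℕ (suc n)) c)) (trans (cong lastUnit (punchIn-fromℕ c)) (lastUnit-inject₁ c))))
    (trans (cong (sign (fromℕ (suc n)) *_) (*-zeroʳ (M zero (fromℕ (suc n))))) (*-zeroʳ (sign (fromℕ (suc n)))))
  innerTerm : ∀ j → laplaceTerm M (inject₁ j) ≡ laplaceTerm M′ j
  innerTerm j = cong₂ (λ s D → s * (M zero (inject₁ j) * D)) (sign-inject₁ j) (begin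
    det (suc n) (minor M (inject₁ j))
      ≡⟨ det-lastRowUnit n (minor M (inject₁ j)) (λ c → trans (Mₗ (punchIn (inject₁ j) c)) (lastUnit-punchIn j c)) ⟩
    det n (λ r c → M (suc (inject₁ r)) (punchIn (inject₁ j) (inject₁ c)))
      ≡⟨ det-cong n {λ r c → M (suc (inject₁ r)) (punchIn (inject₁ j) (inject₁ c))} {minor M′ j}
                  (λ r c → cong (M (suc (inject₁ r))) (punchIn-inject₁ j c)) ⟩
    det n (minor M′ j)
      ∎)

-- Linear functionals and bordered determinants

Linear : ∀ {m} → (Point m → ℚ) → Set
Linear {m} F = ∀ a b (ρ ρ₁ ρ₂ : Point m) → (∀ c → ρ c ≡ a * ρ₁ c + b * ρ₂ c) → F ρ ≡ a * F ρ₁ + b * F ρ₂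

module _ {m} {F : Point m → ℚ} (F-linear : Linear F) where

  linear-cong : ∀ {ρ ρ′} → (∀ c → ρ c ≡ ρ′ c) → F ρ ≡ F ρ′
  linear-cong {ρ} {ρ′} ρ≈ρ′ = trans (F-linear 1ℚ 0ℚ ρ ρ′ ρ′ (λ c → trans (ρ≈ρ′ c) (sym (unit (ρ′ c))))) (unit (F ρ′))
    where
    unit : ∀ x → 1ℚ * x + 0ℚ * x ≡ x
    unit = solve-∀ ℚ-ring

  linear-sub : ∀ {ρ ρ₁ ρ₂} → (∀ c → ρ c ≡ ρ₁ c - ρ₂ c) → F ρ ≡ F ρ₁ - F ρ₂
  linear-sub {ρ} {ρ₁} {ρ₂} ρ≈ = trans (F-linear 1ℚ (- 1ℚ) ρ ρ₁ ρ₂ (λ c → trans (ρ≈ c) (difference (ρ₁ c) (ρ₂ c))))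
                                       (sym (difference (F ρ₁) (F ρ₂)))
    where
    difference : ∀ x y → x - y ≡ 1ℚ * x + - 1ℚ * y
    difference = solve-∀ ℚ-ring

  linear-sumF : ∀ {k} (λs : Fin k → ℚ) (ρs : Fin k → Point m) {ρ} →
                (∀ c → ρ c ≡ sumF (λ i → λs i * ρs i c)) → F ρ ≡ sumF (λ i → λs i * F (ρs i))
  linear-sumF {zero} λs ρs {ρ} ρ≈0 =
    trans (F-linear 0ℚ 0ℚ ρ ρ ρ (λ c → trans (ρ≈0 c) (sym (zeros (ρ c))))) (zeros (F ρ))
    where
    zeros : ∀ x → 0ℚ * x + 0ℚ * x ≡ 0ℚ
    zeros = solve-∀ ℚ-ring
  linear-sumF {suc k} λs ρs {ρ} ρ≈ = begin
    F ρ
      ≡⟨ F-linear (λs zero) 1ℚ ρ (ρs zero) rest (λ c → trans (ρ≈ c) (cong (λs zero * ρs zero c +_) (sym (*-identityˡ _)))) ⟩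
    λs zero * F (ρs zero) + 1ℚ * F rest
      ≡⟨ cong (λs zero * F (ρs zero) +_) (trans (*-identityˡ _) (linear-sumF (λs ∘ suc) (ρs ∘ suc) (λ c → refl))) ⟩
    sumF (λ i → λs i * F (ρs i))
      ∎
    where
    open ≡-Reasoning
    rest : Point m
    rest c = sumF (λ i → λs (suc i) * ρs (suc i) c)

appendRow-fromℕ : ∀ {d k} (f : Fin k → Point d) w → appendRow f w (fromℕ k) ≡ w
appendRow-fromℕ {k = zero}  f w = refl
appendRow-fromℕ {k = suc k} f w = appendRow-fromℕ (f ∘ suc) w

appendRow-inject₁ : ∀ {d k} (f : Fin k → Point d) w r → appendRow f w (inject₁ r) ≡ f r
appendRow-inject₁ {k = suc k} f w zero    = refl
appendRow-inject₁ {k = suc k} f w (suc r) = appendRow-inject₁ (f ∘ suc) w r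

appendRow-≢fromℕ : ∀ {d k} (f : Fin k → Point d) w w′ {r} → r ≢ fromℕ k → appendRow f w r ≡ appendRow f w′ r
appendRow-≢fromℕ {k = zero}  f w w′ {zero}  r≢last = contradiction refl r≢last
appendRow-≢fromℕ {k = suc k} f w w′ {zero}  r≢last = refl
appendRow-≢fromℕ {k = suc k} f w w′ {suc r} r≢last = appendRow-≢fromℕ (f ∘ suc) w w′ (r≢last ∘ cong suc)

appendRow-map : ∀ {d e k} (E : Point d → Point e) (f : Fin k → Point d) w r →
                E (appendRow f w r) ≡ appendRow (E ∘ f) (E w) r
appendRow-map {k = zero}  E f w zero    = refl
appendRow-map {k = suc k} E f w zero    = refl
appendRow-map {k = suc k} E f w (suc r) = appendRow-map E (f ∘ suc) w r

bordered : ∀ {k} → (Fin k → Point (suc k)) → Point (suc k) → ℚ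
bordered {k} A ρ = det (suc k) (appendRow A ρ)

bordered-linear : ∀ {k} (A : Fin k → Point (suc k)) → Linear (bordered A)
bordered-linear {k} A a b ρ ρ₁ ρ₂ ρ≈ = det-linear (suc k) (fromℕ k) a b
  (λ i i≢last c → cong (λ row → row c) (appendRow-≢fromℕ A ρ₁ ρ i≢last))
  (λ i i≢last c → cong (λ row → row c) (appendRow-≢fromℕ A ρ₂ ρ i≢last))
  (λ c → begin
    appendRow A ρ (fromℕ k) c
      ≡⟨ cong (λ row → row c) (appendRow-fromℕ A ρ) ⟩
    ρ c
      ≡⟨ ρ≈ c ⟩
    a * ρ₁ c + b * ρ₂ c
      ≡⟨ sym (cong₂ (λ x y → a * x c + b * y c) (appendRow-fromℕ A ρ₁) (appendRow-fromℕ A ρ₂)) ⟩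
    a * appendRow A ρ₁ (fromℕ k) c + b * appendRow A ρ₂ (fromℕ k) c
      ∎)
  where open ≡-Reasoning

bordered-repeatedRow : ∀ {k} (A : Fin k → Point (suc k)) {ρ} s → (∀ c → ρ c ≡ A s c) → bordered A ρ ≡ 0ℚ
bordered-repeatedRow {k} A {ρ} s ρ≈As = det-equalRows (suc k) (appendRow A ρ) {inject₁ s} {fromℕ k}
  (fromℕ≢inject₁ ∘ sym)
  (λ c → trans (cong (λ row → row c) (appendRow-inject₁ A ρ s))
               (trans (sym (ρ≈As c)) (sym (cong (λ row → row c) (appendRow-fromℕ A ρ)))))

bordered-lastUnit : ∀ {k} (A : Fin k → Point (suc k)) → bordered A lastUnit ≡ det k (λ r c → A r (inject₁ c))
bordered-lastUnit {k} A = trans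
  (det-lastRowUnit k (appendRow A lastUnit) (λ c → cong (λ row → row c) (appendRow-fromℕ A lastUnit)))
  (det-cong k (λ r c → cong (λ row → row (inject₁ c)) (appendRow-inject₁ A lastUnit r)))

-- Lattice-face simplices

indicator : ∀ {n} → Fin n → Fin n → ℚ
indicator w r with r ≟ᶠ w
... | yes _ = 1ℚ
... | no _  = 0ℚ

indicator-scaling : ∀ {n} (f : Fin n → ℚ) w r → (r ≢ w → f r ≡ 0ℚ) → f r ≡ indicator w r * f w
indicator-scaling f w r vanish with r ≟ᶠ w
... | yes refl = sym (*-identityˡ (f w))
... | no r≢w   = trans (vanish r≢w) (sym (*-zeroˡ (f w)))

homogenize : ∀ {m n} {U : Fin m → Point n} {x} (A : InAffSpan U x) →
             ∀ c → (1ℚ ∷ x) c ≡ sumF (λ i → proj₁ A i * (1ℚ ∷ U i) c)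
homogenize (λs , Σλs≡1 , x≈) zero    = trans (sym Σλs≡1) (sumF-cong (λ i → sym (*-identityʳ (λs i))))
homogenize (λs , Σλs≡1 , x≈) (suc c) = x≈ c

InAffSpan-π : ∀ {m n} {U : Fin m → Point (suc n)} {x} → InAffSpan U x → InAffSpan (π ∘ U) (π x)
InAffSpan-π (λs , Σλs≡1 , x≈) = λs , Σλs≡1 , x≈ ∘ inject₁

linear-affine : ∀ {m n} {F : Point (suc n) → ℚ} → Linear F →
                {U : Fin m → Point n} {x : Point n} (A : InAffSpan U x) →
                F (1ℚ ∷ x) ≡ sumF (λ i → proj₁ A i * F (1ℚ ∷ U i))
linear-affine F-linear {U} A = linear-sumF F-linear (proj₁ A) (λ i → 1ℚ ∷ U i) (homogenize A)

lift-difference : ∀ {m} (a₀ a₁ b₀ b₁ : Point (suc m)) → (∀ c → π b₀ c ≡ π a₀ c) → (∀ c → π b₁ c ≡ π a₁ c) →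
                  ∀ c → (1ℚ ∷ b₁) c - (1ℚ ∷ b₀) c
                      ≡ 1ℚ * ((1ℚ ∷ a₁) c - (1ℚ ∷ a₀) c)
                        + ((b₁ (fromℕ m) - b₀ (fromℕ m)) - (a₁ (fromℕ m) - a₀ (fromℕ m))) * lastUnit c
lift-difference {m} a₀ a₁ b₀ b₁ πb₀≈ πb₁≈ = difference
  where
  open ≡-Reasoning
  L = fromℕ m
  N = (b₁ L - b₀ L) - (a₁ L - a₀ L)
  difference : ∀ c → (1ℚ ∷ b₁) c - (1ℚ ∷ b₀) c ≡ 1ℚ * ((1ℚ ∷ a₁) c - (1ℚ ∷ a₀) c) + N * lastUnit c
  difference zero = homogeneousCoordinate N
    where
    homogeneousCoordinate : ∀ N → 1ℚ - 1ℚ ≡ 1ℚ * (1ℚ - 1ℚ) + N * 0ℚ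
    homogeneousCoordinate = solve-∀ ℚ-ring
  difference (suc c) with injectOrLast c
  ... | inner j = begin
    b₁ (inject₁ j) - b₀ (inject₁ j)                  ≡⟨ cong₂ _-_ (πb₁≈ j) (πb₀≈ j) ⟩
    a₁ (inject₁ j) - a₀ (inject₁ j)                  ≡⟨ pad (a₁ (inject₁ j) - a₀ (inject₁ j)) N ⟩
    1ℚ * (a₁ (inject₁ j) - a₀ (inject₁ j)) + N * 0ℚ  ≡⟨ cong (λ e → 1ℚ * (a₁ (inject₁ j) - a₀ (inject₁ j)) + N * e)
                                                             (sym (lastUnit-inject₁ j)) ⟩
    1ℚ * (a₁ (inject₁ j) - a₀ (inject₁ j)) + N * lastUnit (inject₁ j) ∎
    where
    pad : ∀ x N → x ≡ 1ℚ * x + N * 0ℚ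
    pad = solve-∀ ℚ-ring
  ... | last = begin
    b₁ L - b₀ L                          ≡⟨ lastCoordinate (b₁ L) (b₀ L) (a₁ L) (a₀ L) ⟩
    1ℚ * (a₁ L - a₀ L) + N * 1ℚ          ≡⟨ cong (λ e → 1ℚ * (a₁ L - a₀ L) + N * e) (sym (lastUnit-fromℕ m)) ⟩
    1ℚ * (a₁ L - a₀ L) + N * lastUnit L  ∎
    where
    lastCoordinate : ∀ y₁ y₀ x₁ x₀ → y₁ - y₀ ≡ 1ℚ * (x₁ - x₀) + ((y₁ - y₀) - (x₁ - x₀)) * 1ℚ
    lastCoordinate = solve-∀ ℚ-ring

module LatticeFaceRatio
  {k} (q : Fin (suc (suc (suc k))) → Point (suc (suc k))) (q-latticeFace : LatticeFaceSimplex (suc k) q)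
  (w u : Fin (suc (suc (suc k)))) {F : Point (suc (suc (suc k))) → ℚ} {G : Point (suc (suc k)) → ℚ}
  (F-linear : Linear F) (G-linear : Linear G)
  (F-vanish : ∀ r → r ≢ w → F (1ℚ ∷ q r) ≡ 0ℚ) (G-vanish : ∀ r → r ≢ w → r ≢ u → G (1ℚ ∷ π (q r)) ≡ 0ℚ)
  where

  Lift : Fin (suc (suc (suc k))) → Point (suc k) → Set
  Lift i y = Σ (Point (suc (suc k))) λ x → InAffSpan (q ∘ punchIn i) x × IntPoint x × (∀ c → π x c ≡ y c)

  lift : ∀ i y → IntPoint y → Lift i y
  lift i y y∈ℤ = Equivalence.to (proj₂ (proj₂ q-latticeFace i) y) y∈ℤ

  origin : Point (suc k)
  origin _ = 0ℚ

  weight : ∀ {x} → InAffSpan (q ∘ punchIn u) x → ℚ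
  weight (λs , _) = sumF (λ i → λs i * indicator w (punchIn u i))

  F-oppositeW : ∀ {x} (A : InAffSpan (q ∘ punchIn w) x) → F (1ℚ ∷ x) ≡ 0ℚ
  F-oppositeW A = trans (linear-affine F-linear {U = q ∘ punchIn w} A) (sumF-zero λ i →
    trans (cong (proj₁ A i *_) (F-vanish (punchIn w i) (punchInᵢ≢i w i))) (*-zeroʳ (proj₁ A i)))

  F-oppositeU : ∀ {x} (B : InAffSpan (q ∘ punchIn u) x) → F (1ℚ ∷ x) ≡ weight B * F (1ℚ ∷ q w)
  F-oppositeU B = trans (linear-affine F-linear {U = q ∘ punchIn u} B)
    (sumF-scaled (proj₁ B) (indicator w ∘ punchIn u) _ λ i →
      indicator-scaling (λ r → F (1ℚ ∷ q r)) w (punchIn u i) (F-vanish (punchIn u i)))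

  G-oppositeU : ∀ {x} (B : InAffSpan (q ∘ punchIn u) x) → G (1ℚ ∷ π x) ≡ weight B * G (1ℚ ∷ π (q w))
  G-oppositeU B = trans (linear-affine G-linear {U = π ∘ q ∘ punchIn u} (InAffSpan-π {U = q ∘ punchIn u} B))
    (sumF-scaled (proj₁ B) (indicator w ∘ punchIn u) _ λ i →
      indicator-scaling (λ r → G (1ℚ ∷ π (q r))) w (punchIn u i) (λ ≢w → G-vanish (punchIn u i) ≢w (punchInᵢ≢i u i)))

  [x-y]z≡xz-yz : ∀ x y z → (x - y) * z ≡ x * z - y * z
  [x-y]z≡xz-yz = solve-∀ ℚ-ring

  equations : Lift w origin → Lift w lastUnit → Lift u origin → Lift u lastUnit →
              ∃₂ λ μ N → IsInt N × μ * F (1ℚ ∷ q w) ≡ N * F lastUnit × μ * G (1ℚ ∷ π (q w)) ≡ G lastUnit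
  equations (a₀ , A₀ , a₀∈ℤ , πa₀) (a₁ , A₁ , a₁∈ℤ , πa₁) (b₀ , B₀ , b₀∈ℤ , πb₀) (b₁ , B₁ , b₁∈ℤ , πb₁) =
    μ , N , N∈ℤ , F-equation , G-equation
    where
    open ≡-Reasoning
    L = fromℕ (suc k)
    N = (b₁ L - b₀ L) - (a₁ L - a₀ L)
    N∈ℤ : IsInt N
    N∈ℤ = IsInt-- (IsInt-- (b₁∈ℤ L) (b₀∈ℤ L)) (IsInt-- (a₁∈ℤ L) (a₀∈ℤ L))
    μ = weight B₁ - weight B₀

    F-equation : μ * F (1ℚ ∷ q w) ≡ N * F lastUnit
    F-equation = begin
      μ * F (1ℚ ∷ q w)
        ≡⟨ [x-y]z≡xz-yz (weight B₁) (weight B₀) _ ⟩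
      weight B₁ * F (1ℚ ∷ q w) - weight B₀ * F (1ℚ ∷ q w)
        ≡⟨ sym (cong₂ _-_ (F-oppositeU B₁) (F-oppositeU B₀)) ⟩
      F (1ℚ ∷ b₁) - F (1ℚ ∷ b₀)
        ≡⟨ sym (linear-sub F-linear (λ _ → refl)) ⟩
      F (λ c → (1ℚ ∷ b₁) c - (1ℚ ∷ b₀) c)
        ≡⟨ F-linear 1ℚ N _ _ lastUnit (lift-difference a₀ a₁ b₀ b₁ (λ c → trans (πb₀ c) (sym (πa₀ c)))
                                                                   (λ c → trans (πb₁ c) (sym (πa₁ c)))) ⟩
      1ℚ * F (λ c → (1ℚ ∷ a₁) c - (1ℚ ∷ a₀) c) + N * F lastUnit
        ≡⟨ cong (λ x → 1ℚ * x + N * F lastUnit) (linear-sub F-linear (λ _ → refl)) ⟩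
      1ℚ * (F (1ℚ ∷ a₁) - F (1ℚ ∷ a₀)) + N * F lastUnit
        ≡⟨ cong₂ (λ x y → 1ℚ * (x - y) + N * F lastUnit) (F-oppositeW A₁) (F-oppositeW A₀) ⟩
      1ℚ * (0ℚ - 0ℚ) + N * F lastUnit
        ≡⟨ dropZero N (F lastUnit) ⟩
      N * F lastUnit
        ∎
      where
      dropZero : ∀ x y → 1ℚ * (0ℚ - 0ℚ) + x * y ≡ x * y
      dropZero = solve-∀ ℚ-ring

    πb-difference : ∀ c → lastUnit c ≡ (1ℚ ∷ π b₁) c - (1ℚ ∷ π b₀) c
    πb-difference zero    = sym (x-x≡0 1ℚ)
    πb-difference (suc c) = sym (trans (cong₂ _-_ (πb₁ c) (πb₀ c)) (x-0≡x (lastUnit c)))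

    G-equation : μ * G (1ℚ ∷ π (q w)) ≡ G lastUnit
    G-equation = begin
      μ * G (1ℚ ∷ π (q w))
        ≡⟨ [x-y]z≡xz-yz (weight B₁) (weight B₀) _ ⟩
      weight B₁ * G (1ℚ ∷ π (q w)) - weight B₀ * G (1ℚ ∷ π (q w))
        ≡⟨ sym (cong₂ _-_ (G-oppositeU B₁) (G-oppositeU B₀)) ⟩
      G (1ℚ ∷ π b₁) - G (1ℚ ∷ π b₀)
        ≡⟨ sym (linear-sub G-linear πb-difference) ⟩
      G lastUnit
        ∎

  ratio-integral : IsInt ((F (1ℚ ∷ q w) ÷₀ F lastUnit) ÷₀ (G (1ℚ ∷ π (q w)) ÷₀ G lastUnit))
  ratio-integral = conclude (equations (lift w origin origin-integral) (lift w lastUnit lastUnit-integral)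
                                       (lift u origin origin-integral) (lift u lastUnit lastUnit-integral))
    where
    origin-integral : IntPoint origin
    origin-integral _ = ℤ.+ 0 , refl
    conclude : (∃₂ λ μ N → IsInt N × μ * F (1ℚ ∷ q w) ≡ N * F lastUnit × μ * G (1ℚ ∷ π (q w)) ≡ G lastUnit) →
               IsInt ((F (1ℚ ∷ q w) ÷₀ F lastUnit) ÷₀ (G (1ℚ ∷ π (q w)) ÷₀ G lastUnit))
    conclude (μ , N , N∈ℤ , F-equation , G-equation) = ratio-of-ratios-integral {μ = μ} N∈ℤ F-equation G-equation

firstCoordinate-integral : ∀ m (p : Fin (suc (suc m)) → Point (suc m)) → LatticeFaceSimplex m p →
                           ∀ i → IsInt (p i zero)
firstCoordinate-integral zero    p (_ , integral) i = integral i
firstCoordinate-integral (suc m) p (_ , faces)    i =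
  subst (λ r → IsInt (p r zero)) (punchIn-punchOut other≢i)
        (firstCoordinate-integral m _ (proj₁ (faces other)) (punchOut other≢i))
  where
  other = punchIn i zero
  other≢i = punchInᵢ≢i i zero

truncate : ∀ {m n} → m ≤ n → Point n → Point m
truncate m≤n x c = x (inject≤ c m≤n)

Covers : ∀ {a b} {A : Set} → (Fin a → A) → (Fin b → A) → Set
Covers g t = ∀ s → ∃ λ r → g r ≡ t s

value-outside : ∀ {a b N} (g : Fin a → Fin N) (t : Fin b → Fin N) → Injective _≡_ _≡_ g → b < a →
                ∃ λ r → ¬ ∃ λ s → t s ≡ g r
value-outside {a} g t g-injective b<a =
  ¬∀⟶∃¬ a (λ r → ∃ λ s → t s ≡ g r) (λ r → any? (λ s → t s ≟ᶠ g r)) λ inImage →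
    <⇒notInjective {f = proj₁ ∘ inImage} b<a λ {r} {r′} eq →
      g-injective (trans (sym (proj₂ (inImage r))) (trans (cong t eq) (proj₂ (inImage r′))))

Covers-reverse : ∀ {K N} (g t : Fin K → Fin N) → Injective _≡_ _≡_ g → Injective _≡_ _≡_ t →
                 Covers g t → Covers t g
Covers-reverse {suc K} g t g-injective t-injective g-covers r with any? (λ s → t s ≟ᶠ g r)
... | yes hit   = hit
... | no  ¬hit  = contradiction (λ {s} {s′} eq → t-injective (trans (sym (proj₂ (g-covers s)))
                     (trans (cong g (punchOut-injective (avoids s) (avoids s′) eq)) (proj₂ (g-covers s′)))))
                  (<⇒notInjective {f = λ s → punchOut (avoids s)} (ℕ.n<1+n K))
  where
  avoids : ∀ s → r ≢ proj₁ (g-covers s)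
  avoids s r≡ = ¬hit (s , sym (trans (cong g r≡) (proj₂ (g-covers s))))

module _ {n K} (v : Fin (suc (suc n)) → Point (suc n)) (t : Fin K → Fin (suc (suc n))) where

  record Face (m : ℕ) : Set where
    field
      m≤n         : m ≤ n
      vertex      : Fin (suc (suc m)) → Point (suc m)
      index       : Fin (suc (suc m)) → Fin (suc (suc n))
      latticeFace : LatticeFaceSimplex m vertex
      truncation  : ∀ r c → vertex r c ≡ truncate (s≤s m≤n) (v (index r)) c
      injective   : Injective _≡_ _≡_ index
      covers      : Covers index t

  whole : LatticeFaceSimplex n v → Face n
  whole v-latticeFace = record
    { m≤n         = ℕ.≤-refl
    ; vertex      = v
    ; index       = λ r → r
    ; latticeFace = v-latticeFace
    ; truncation  = λ r c → cong (v r) (sym (inject≤-refl c _))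
    ; injective   = λ eq → eq
    ; covers      = λ s → t s , refl
    }

  shrink : ∀ {m} → K < suc (suc (suc m)) → Face (suc m) → Face m
  shrink K<m+3 face = record
    { m≤n         = ℕ.<⇒≤ m≤n
    ; vertex      = λ r → π (vertex (punchIn r₀ r))
    ; index       = λ r → index (punchIn r₀ r)
    ; latticeFace = proj₁ (proj₂ latticeFace r₀)
    ; truncation  = λ r c → trans (truncation (punchIn r₀ r) (inject₁ c))
                                  (cong (v (index (punchIn r₀ r))) (inject≤-inject₁ c _ _))
    ; injective   = punchIn-injective r₀ _ _ ∘ injective
    ; covers      = λ s → punchOut (r₀≢ s) ,
                          trans (cong index (punchIn-punchOut (r₀≢ s))) (proj₂ (covers s))
    }
    where
    open Face face
    outside = value-outside index t injective K<m+3
    r₀ = proj₁ outside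
    r₀≢ : ∀ s → r₀ ≢ proj₁ (covers s)
    r₀≢ s r₀≡ = proj₂ outside (s , sym (trans (cong index r₀≡) (proj₂ (covers s))))

  descend : ∀ {k m} → K ≡ suc (suc k) → k ≤′ m → Face m → Face k
  descend refl ≤′-refl         face = face
  descend refl (≤′-step k≤′m) face =
    descend refl k≤′m (shrink (s≤s (s≤s (s≤s (ℕ.≤′⇒≤ k≤′m)))) face)

  module _ {m} (face : Face m) where
    open Face face

    homogeneous-vertex : ∀ (p : suc m ≤ suc n) r c → (1ℚ ∷ vertex r) c ≡ rowEntries p (v (index r)) c
    homogeneous-vertex p r zero    = refl
    homogeneous-vertex p r (suc c) = truncation r c

    homogeneous-πvertex : ∀ (p : m ≤ suc n) r c → (1ℚ ∷ π (vertex r)) c ≡ rowEntries p (v (index r)) c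
    homogeneous-πvertex p r zero    = refl
    homogeneous-πvertex p r (suc c) =
      trans (truncation r (inject₁ c)) (cong (v (index r)) (inject≤-inject₁ c _ _))

module _ {d} (v : Fin (suc d) → Point d) (σ : Permutation′ d) where

  det-Xmat : ∀ k (k≤d : k ≤ d) → det (suc k) (Xmat v σ k k≤d)
                                ≡ bordered (λ s → rowEntries k≤d (vσ v σ k≤d s)) (rowEntries k≤d (v (fromℕ d)))
  det-Xmat k k≤d = det-cong (suc k) λ r c →
    cong (λ row → row c) (appendRow-map (rowEntries k≤d) (vσ v σ k≤d) (v (fromℕ d)) r)

  det-Ymat : ∀ k (sk≤d : suc k ≤ d) →
             det (suc k) (Ymat v σ k sk≤d) ≡ bordered (λ s → rowEntries sk≤d (vσ v σ sk≤d s)) lastUnit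
  det-Ymat k sk≤d = sym (trans
    (bordered-lastUnit (λ s → rowEntries sk≤d (vσ v σ sk≤d s)))
    (det-cong (suc k) {λ r c → rowEntries sk≤d (vσ v σ sk≤d r) (inject₁ c)} {Ymat v σ k sk≤d}
       λ { r zero → refl ; r (suc c) → cong (vσ v σ sk≤d r) (inject≤-inject₁ c _ _) }))

-- The ratio z(σ, k+2) / z(σ, k+1), read off the face spanned by v_{σ(1)}, …, v_{σ(k+2)} and v_{d+1};
-- t lists the indices of these vertices, v_{d+1} first.
module ConsecutiveRatio {n} (v : Fin (suc (suc n)) → Point (suc n)) (v-latticeFace : LatticeFaceSimplex n v)
                        (σ : Permutation′ (suc n)) {k} (sk≤d : suc (suc k) ≤ suc n) where

  k≤d : suc k ≤ suc n
  k≤d = ≤-trans (n≤1+n (suc k)) sk≤d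

  τ : Fin (suc (suc k)) → Fin (suc (suc n))
  τ s = inject₁ (σ ⟨$⟩ʳ inject≤ s sk≤d)

  t : Fin (suc (suc (suc k))) → Fin (suc (suc n))
  t = fromℕ (suc n) ∷ τ

  t-injective : Injective _≡_ _≡_ t
  t-injective {zero}  {zero}   _  = refl
  t-injective {zero}  {suc s}  eq = contradiction eq fromℕ≢inject₁
  t-injective {suc s} {zero}   eq = contradiction (sym eq) fromℕ≢inject₁
  t-injective {suc s} {suc s′} eq =
    cong suc (inject≤-injective sk≤d sk≤d s s′ (σ-injective (inject₁-injective eq)))
    where
    σ-injective : ∀ {i j} → σ ⟨$⟩ʳ i ≡ σ ⟨$⟩ʳ j → i ≡ j
    σ-injective σi≡σj = trans (sym (inverseˡ σ)) (trans (cong (σ ⟨$⟩ˡ_) σi≡σj) (inverseˡ σ))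

  face : Face v t (suc k)
  face = descend v t refl (ℕ.≤⇒≤′ (ℕ.≤-pred sk≤d)) (whole v t v-latticeFace)

  open Face face

  within : Covers t index
  within = Covers-reverse index t injective t-injective covers

  w u : Fin (suc (suc (suc k)))
  w = proj₁ (covers zero)
  u = proj₁ (covers (suc (fromℕ (suc k))))

  index-w : index w ≡ fromℕ (suc n)
  index-w = proj₂ (covers zero)

  index-u : index u ≡ τ (fromℕ (suc k))
  index-u = proj₂ (covers (suc (fromℕ (suc k))))

  A₊ : Fin (suc (suc k)) → Point (suc (suc (suc k)))
  A₊ s = rowEntries sk≤d (vσ v σ sk≤d s)

  A : Fin (suc k) → Point (suc (suc k))
  A s = rowEntries k≤d (vσ v σ k≤d s)

  ≢w⇒≢zero : ∀ {r s} → r ≢ w → t s ≡ index r → s ≢ zero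
  ≢w⇒≢zero r≢w ts≡ refl = r≢w (injective (trans (sym ts≡) (sym index-w)))

  A₊-vanish : ∀ r → r ≢ w → bordered A₊ (1ℚ ∷ vertex r) ≡ 0ℚ
  A₊-vanish r r≢w with within r
  ... | zero  , ts≡ = contradiction refl (≢w⇒≢zero r≢w ts≡)
  ... | suc s , ts≡ = bordered-repeatedRow A₊ s λ c →
    trans (homogeneous-vertex v t face sk≤d r c) (cong (λ i → rowEntries sk≤d (v i) c) (sym ts≡))

  A-vanish : ∀ r → r ≢ w → r ≢ u → bordered A (1ℚ ∷ π (vertex r)) ≡ 0ℚ
  A-vanish r r≢w r≢u with within r
  ... | zero  , ts≡ = contradiction refl (≢w⇒≢zero r≢w ts≡)
  ... | suc s , ts≡ with injectOrLast s
  ...   | last    = contradiction (injective (trans (sym ts≡) (sym index-u))) r≢u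
  ...   | inner j = bordered-repeatedRow A j λ c →
    trans (homogeneous-πvertex v t face k≤d r c)
          (cong (λ i → rowEntries k≤d (v i) c) (trans (sym ts≡) (cong (inject₁ ∘ (σ ⟨$⟩ʳ_)) (inject≤-inject₁ j _ _))))

  integral : IsInt (z v σ (suc (suc k)) sk≤d ÷₀ z v σ (suc k) k≤d)
  integral = subst IsInt
    (cong₂ _÷₀_ (cong₂ _÷₀_ X₊-equation (sym (det-Ymat v σ (suc k) sk≤d)))
                (cong₂ _÷₀_ X-equation  (sym (det-Ymat v σ k k≤d))))
    (LatticeFaceRatio.ratio-integral vertex latticeFace w u (bordered-linear A₊) (bordered-linear A)
                                     A₊-vanish A-vanish)
    where
    lastVertexRow : ∀ {m} (p : m ≤ suc n) c → rowEntries p (v (index w)) c ≡ rowEntries p (v (fromℕ (suc n))) c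
    lastVertexRow p c = cong (λ i → rowEntries p (v i) c) index-w
    X₊-equation : bordered A₊ (1ℚ ∷ vertex w) ≡ det (suc (suc (suc k))) (Xmat v σ (suc (suc k)) sk≤d)
    X₊-equation = trans
      (linear-cong (bordered-linear A₊) λ c → trans (homogeneous-vertex v t face sk≤d w c) (lastVertexRow sk≤d c))
      (sym (det-Xmat v σ (suc (suc k)) sk≤d))
    X-equation : bordered A (1ℚ ∷ π (vertex w)) ≡ det (suc (suc k)) (Xmat v σ (suc k) k≤d)
    X-equation = trans
      (linear-cong (bordered-linear A) λ c → trans (homogeneous-πvertex v t face k≤d w c) (lastVertexRow k≤d c))
      (sym (det-Xmat v σ (suc k) k≤d))

firstRatio : ∀ n (v : Fin (suc (suc n)) → Point (suc n)) (σ : Permutation′ (suc n)) (1≤d : 1 ≤ suc n) →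
             z v σ 1 1≤d ÷₀ z v σ 0 (≤-trans (n≤1+n 0) 1≤d)
             ≡ v (fromℕ (suc n)) zero - v (inject₁ (σ ⟨$⟩ʳ zero)) zero
firstRatio n v σ 1≤d = begin
  (det 2 X ÷₀ 1ℚ) ÷₀ 1ℚ  ≡⟨ p÷₀1≡p _ ⟩
  det 2 X ÷₀ 1ℚ          ≡⟨ p÷₀1≡p _ ⟩
  det 2 X                ≡⟨ det₂ X ⟩
  1ℚ * x - y * 1ℚ        ≡⟨ simplify x y ⟩
  x - y                  ∎
  where
  open ≡-Reasoning
  X = Xmat v σ 1 1≤d
  x = v (fromℕ (suc n)) zero
  y = v (inject₁ (σ ⟨$⟩ʳ zero)) zero
  simplify : ∀ x y → 1ℚ * x - y * 1ℚ ≡ x - y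
  simplify = solve-∀ ℚ-ring

lemma5p6 : (n : ℕ) (v : Fin (suc (suc n)) → Point (suc n)) →
    LatticeFaceSimplex n v →
    (σ : Permutation′ (suc n)) (k : ℕ) (sk≤d : suc k ≤ suc n) →
    IsInt (z v σ (suc k) sk≤d ÷₀ z v σ k (≤-trans (n≤1+n k) sk≤d))
lemma5p6 n v v-latticeFace σ zero    1≤d  = subst IsInt (sym (firstRatio n v σ 1≤d))
  (IsInt-- (firstCoordinate-integral n v v-latticeFace _) (firstCoordinate-integral n v v-latticeFace _))
lemma5p6 n v v-latticeFace σ (suc k) sk≤d = ConsecutiveRatio.integral v v-latticeFace σ sk≤d
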